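{- Let $w_{1},w_{2},w_{3}$ be any positive integers and $n\ge 0$ an integer. Then for all $y_1,y_2,y_3$ the following six expressions are equal: \begin{align*} &\sum_{k+l+m=n}\binom{n}{k,l,m}E_{k}(w_{1}y_{1})E_{l}(w_{2}y_{2})E_{m}(w_{3}y_{3})w_{1}^{l+m}w_{2}^{k+m}w_{3}^{k+l}\\ =&\sum_{k+l+m=n}\binom{n}{k,l,m}E_{k}(w_{1}y_{1})E_{l}(w_{3}y_{2})E_{m}(w_{2}y_{3})w_{1}^{l+m}w_{3}^{k+m}w_{2}^{k+l}\\ =&\sum_{k+l+m=n}\binom{n}{k,l,m}E_{k}(w_{2}y_{1})E_{l}(w_{1}y_{2})E_{m}(w_{3}y_{3})w_{2}^{l+m}w_{1}^{k+m}w_{3}^{k+l}\\ =&\sum_{k+l+m=n}\binom{n}{k,l,m}E_{k}(w_{2}y_{1})E_{l}(w_{3}y_{2})E_{m}(w_{1}y_{3})w_{2}^{l+m}w_{3}^{k+m}w_{1}^{k+l}\\ =&\sum_{k+l+m=n}\binom{n}{k,l,m}E_{k}(w_{3}y_{1})E_{l}(w_{1}y_{2})E_{m}(w_{2}y_{3})w_{3}^{l+m}w_{1}^{k+m}w_{2}^{k+l}\\ =&\sum_{k+l+m=n}\binom{n}{k,l,m}E_{k}(w_{3}y_{1})E_{l}(w_{2}y_{2})E_{m}(w_{1}y_{3})w_{3}^{l+m}w_{2}^{k+m}w_{1}^{k+l}. \end{align*}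
   Context: The Euler polynomials $E_n(x)$ are defined by $\frac{2}{e^{t}+1}e^{xt}=\sum_{n=0}^{\infty}E_{n}(x)\frac{t^{n}}{n!}$. Sums $\sum_{k+l+m=n}$ run over all nonnegative integers $k,l,m$ with $k+l+m=n$, and $\binom{n}{k,l,m}=\frac{n!}{k!\,l!\,m!}$. -}

module Defs where

open import Level using (Level)
open import Algebra.Bundles using (CommutativeRing)
open import Data.Nat as ℕ using (ℕ; zero; suc; _∸_; _!; NonZero)
open import Data.Nat.Properties using (_!≢0; m*n≢0)
open import Data.Nat.DivMod using (_/_)
open import Data.Nat.Combinatorics using (_C_)

-- Multinomial coefficient  n! / (k! l! m!)  (exact division when k+l+m = n).
multinomial : ℕ → ℕ → ℕ → ℕ → ℕ
multinomial n k l m = (n ! / ((k ! ℕ.* l !) ℕ.* m !)) {{nz}}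
  where
  nz : NonZero ((k ! ℕ.* l !) ℕ.* m !)
  nz = m*n≢0 (k ! ℕ.* l !) (m !) {{m*n≢0 (k !) (l !) {{k !≢0}} {{l !≢0}}}} {{m !≢0}}

-- Everything below lives in an arbitrary commutative ring R, given an
-- element h which (in the statement) is assumed to be an inverse of 2.
module Ring {c ℓ : Level} (R : CommutativeRing c ℓ) where
  open CommutativeRing R using (Carrier; _+_; _*_; _-_; 0#; 1#)

  fromℕ : ℕ → Carrier
  fromℕ zero    = 0#
  fromℕ (suc n) = 1# + fromℕ n

  pow : Carrier → ℕ → Carrier
  pow x zero    = 1#
  pow x (suc n) = x * pow x n

  -- Euler polynomials E_n(x), with h = 1/2.
  -- Comparing coefficients of t^n in (e^t + 1) Σ E_n(x) t^n/n! = 2 e^{xt} gives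
  --   Σ_{k=0}^{n} C(n,k) E_k(x) + E_n(x) = 2 x^n,
  -- i.e.  E_n(x) = x^n - (1/2) Σ_{k=0}^{n-1} C(n,k) E_k(x),  E_0(x) = 1.
  mutual
    E : Carrier → ℕ → Carrier → Carrier
    E h zero    x = 1#
    E h (suc n) x = pow x (suc n) - h * binSum h (suc n) n x

    binSum : Carrier → ℕ → ℕ → Carrier → Carrier
    binSum h N zero    x = fromℕ (N C 0) * E h zero x
    binSum h N (suc m) x = binSum h N m x + fromℕ (N C suc m) * E h (suc m) x

  sumTo : ℕ → (ℕ → Carrier) → Carrier
  sumTo zero    f = f zero
  sumTo (suc m) f = sumTo m f + f (suc m)

  sum3 : ℕ → (ℕ → ℕ → ℕ → Carrier) → Carrier
  sum3 n g = sumTo n (λ k → sumTo (n ∸ k) (λ l → g k l (n ∸ k ∸ l)))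

  S : Carrier → ℕ → Carrier → Carrier → Carrier → Carrier → Carrier → Carrier → Carrier
  S h n a b c′ y₁ y₂ y₃ = sum3 n (λ k l m →
    fromℕ (multinomial n k l m)
      * E h k (a * y₁) * E h l (b * y₂) * E h m (c′ * y₃)
      * pow a (l ℕ.+ m) * pow b (k ℕ.+ m) * pow c′ (k ℕ.+ l))

module Submission where

-- A sequence F : ℕ → R stands for the EGF Σ F n tⁿ/n!.
-- The defining recurrence of the Euler polynomials says that
--   Ê(x,s) := (E_k(x) sᵏ)  satisfies  Ê(x,s) ⋆ (e^{st} + 1) = 2 e^{xst}.
-- Hence T(a,b,c) := Ê(a y₁, bc) ⋆ Ê(b y₂, ac) ⋆ Ê(c y₃, ab) satisfies
--   T(a,b,c) ⋆ (e^{bct}+1)(e^{act}+1)(e^{abt}+1) = 8 e^{abc(y₁+y₂+y₃)t},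
-- and both the right-hand side and the cancelled factor are symmetric in a,b,c.
-- So T is symmetric, and the coefficient of T at n is the sum S of the theorem.

open import Defs
open import Level using (Level)
open import Algebra.Bundles using (CommutativeRing; CommutativeSemigroup)
open import Data.Nat as ℕ using (ℕ; NonZero; zero; suc; _∸_; _!; _≤_; _<_; z≤n; s≤s)
import Data.Nat.Properties as ℕₚ
open import Data.Nat.Combinatorics
  using (_C_; nCn≡1; nCk+nC[k+1]≡[n+1]C[k+1]; k>n⇒nCk≡0; nCk≡n!/k![n-k]!; k![n∸k]!∣n!)
open import Data.Nat.DivMod using (m/n*n≡m; m*n/n≡m; /-congˡ)
open import Data.Nat.Solver using (module +-*-Solver)
open import Data.Product using (_×_; _,_)
open import Data.Sum using (inj₁; inj₂)
open import Relation.Binary.PropositionalEquality as ≡ using (_≡_)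
import Algebra.Solver.CommutativeMonoid as CommutativeMonoidSolver
import Algebra.Properties.CommutativeSemigroup as CommutativeSemigroupProperties

factorial-split : ∀ {n k} → k ≤ n → n ! ≡ (n C k) ℕ.* (k ! ℕ.* (n ∸ k) !)
factorial-split {n} {k} k≤n = ≡.sym (≡.trans
  (≡.cong (ℕ._* (k ! ℕ.* (n ∸ k) !)) (nCk≡n!/k![n-k]! k≤n))
  (m/n*n≡m (k![n∸k]!∣n! k≤n)))
  where instance _ = k ℕₚ.!* (n ∸ k) !≢0

-- The multinomial coefficient factors as C(n,k) · C(n-k,l); this is what turns
-- a nested binomial convolution into the sum over k+l+m = n.
multinomial-split : ∀ {n k l} → k ≤ n → l ≤ n ∸ k →
  multinomial n k l (n ∸ k ∸ l) ≡ (n C k) ℕ.* ((n ∸ k) C l)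
multinomial-split {n} {k} {l} k≤n l≤n-k =
  ≡.trans (/-congˡ n!-factored) (m*n/n≡m ((n C k) ℕ.* ((n ∸ k) C l)) D)
  where
  m = n ∸ k ∸ l
  D = (k ! ℕ.* l !) ℕ.* m !
  instance _ = ℕₚ.m*n≢0 (k ! ℕ.* l !) (m !) {{ℕₚ.m*n≢0 (k !) (l !) {{k ℕₚ.!≢0}} {{l ℕₚ.!≢0}}}} {{m ℕₚ.!≢0}}
  open +-*-Solver
  n!-factored : n ! ≡ ((n C k) ℕ.* ((n ∸ k) C l)) ℕ.* D
  n!-factored = ≡.trans (factorial-split k≤n)
    (≡.trans (≡.cong (λ z → (n C k) ℕ.* (k ! ℕ.* z)) (factorial-split l≤n-k))
      (solve 5 (λ a b c d e → a :* (b :* (c :* (d :* e))) := (a :* c) :* ((b :* d) :* e))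
        ≡.refl (n C k) (k !) ((n ∸ k) C l) (l !) (m !)))

module Series {c ℓ : Level} (R : CommutativeRing c ℓ) where
  open CommutativeRing R
  open Ring R
  open import Relation.Binary.Reasoning.Setoid setoid
  open import Algebra.Properties.Group +-group using (∙-cancelˡ)
  open import Algebra.Properties.AbelianGroup +-abelianGroup using (⁻¹-∙-comm)
  open CommutativeSemigroupProperties +-commutativeSemigroup
    using () renaming (interchange to +-interchange; x∙yz≈y∙xz to +-left-comm; xy∙z≈xz∙y to +-right-comm)
  open CommutativeSemigroupProperties *-commutativeSemigroup
    using () renaming (interchange to *-interchange; x∙yz≈y∙xz to *-left-comm)
  module *-Solver = CommutativeMonoidSolver *-commutativeMonoid

  two : Carrier
  two = 1# + 1#

  two*-double : ∀ x → two * x ≈ x + x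
  two*-double x = trans (distribʳ x 1# 1#) (+-cong (*-identityˡ x) (*-identityˡ x))

  inverse-* : ∀ {u₁ u₂ v₁ v₂} → v₁ * u₁ ≈ 1# → v₂ * u₂ ≈ 1# → (v₁ * v₂) * (u₁ * u₂) ≈ 1#
  inverse-* i₁ i₂ = trans (*-interchange _ _ _ _) (trans (*-cong i₁ i₂) (*-identityˡ 1#))

  fromℕ-+ : ∀ m n → fromℕ (m ℕ.+ n) ≈ fromℕ m + fromℕ n
  fromℕ-+ zero    n = sym (+-identityˡ _)
  fromℕ-+ (suc m) n = trans (+-congˡ (fromℕ-+ m n)) (sym (+-assoc _ _ _))

  fromℕ-* : ∀ m n → fromℕ (m ℕ.* n) ≈ fromℕ m * fromℕ n
  fromℕ-* zero    n = sym (zeroˡ _)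
  fromℕ-* (suc m) n = begin
    fromℕ (n ℕ.+ m ℕ.* n)             ≈⟨ fromℕ-+ n (m ℕ.* n) ⟩
    fromℕ n + fromℕ (m ℕ.* n)         ≈⟨ +-cong (sym (*-identityˡ _)) (fromℕ-* m n) ⟩
    1# * fromℕ n + fromℕ m * fromℕ n  ≈⟨ sym (distribʳ _ _ _) ⟩
    (1# + fromℕ m) * fromℕ n          ∎

  fromℕ-1 : ∀ x → fromℕ 1 * x ≈ x
  fromℕ-1 x = trans (*-congʳ (+-identityʳ 1#)) (*-identityˡ x)

  fromℕ-cong : ∀ {m n} → m ≡ n → fromℕ m ≈ fromℕ n
  fromℕ-cong ≡.refl = refl

  pow-+ : ∀ x m n → pow x (m ℕ.+ n) ≈ pow x m * pow x n
  pow-+ x zero    n = sym (*-identityˡ _)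
  pow-+ x (suc m) n = trans (*-congˡ (pow-+ x m n)) (sym (*-assoc _ _ _))

  pow-* : ∀ x y n → pow (x * y) n ≈ pow x n * pow y n
  pow-* x y zero    = sym (*-identityˡ _)
  pow-* x y (suc n) = trans (*-congˡ (pow-* x y n)) (*-interchange x y (pow x n) (pow y n))

  pow-cong : ∀ {x y} n → x ≈ y → pow x n ≈ pow y n
  pow-cong zero    _   = refl
  pow-cong (suc n) x≈y = *-cong x≈y (pow-cong n x≈y)

  sumTo-cong≤ : ∀ m {f g : ℕ → Carrier} → (∀ k → k ≤ m → f k ≈ g k) → sumTo m f ≈ sumTo m g
  sumTo-cong≤ zero    f≈g = f≈g 0 z≤n
  sumTo-cong≤ (suc m) f≈g =
    +-cong (sumTo-cong≤ m (λ k k≤m → f≈g k (ℕₚ.m≤n⇒m≤1+n k≤m))) (f≈g (suc m) ℕₚ.≤-refl)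

  sumTo-cong : ∀ m {f g : ℕ → Carrier} → (∀ k → f k ≈ g k) → sumTo m f ≈ sumTo m g
  sumTo-cong m f≈g = sumTo-cong≤ m (λ k _ → f≈g k)

  sumTo-shift : ∀ m (f : ℕ → Carrier) → sumTo (suc m) f ≈ f 0 + sumTo m (λ k → f (suc k))
  sumTo-shift zero    f = refl
  sumTo-shift (suc m) f = trans (+-congʳ (sumTo-shift m f)) (+-assoc _ _ _)

  sumTo-+ : ∀ m (f g : ℕ → Carrier) → sumTo m (λ k → f k + g k) ≈ sumTo m f + sumTo m g
  sumTo-+ zero    f g = refl
  sumTo-+ (suc m) f g = trans (+-congʳ (sumTo-+ m f g)) (+-interchange _ _ _ _)

  sumTo-*ˡ : ∀ m x (f : ℕ → Carrier) → x * sumTo m f ≈ sumTo m (λ k → x * f k)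
  sumTo-*ˡ zero    x f = refl
  sumTo-*ˡ (suc m) x f = trans (distribˡ _ _ _) (+-congʳ (sumTo-*ˡ m x f))

  -- Sequences, read as exponential generating functions, up to pointwise ≈.
  Seq : Set c
  Seq = ℕ → Carrier

  infix 4 _≐_
  _≐_ : Seq → Seq → Set ℓ
  F ≐ G = ∀ n → F n ≈ G n

  ≐-refl : ∀ {F} → F ≐ F
  ≐-refl n = refl

  ≐-sym : ∀ {F G} → F ≐ G → G ≐ F
  ≐-sym F≐G n = sym (F≐G n)

  ≐-trans : ∀ {F G H} → F ≐ G → G ≐ H → F ≐ H
  ≐-trans F≐G G≐H n = trans (F≐G n) (G≐H n)

  -- Differentiation of the EGF is the shift.
  ∂ : Seq → Seq
  ∂ F k = F (suc k)

  infixl 6 _⊞_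
  _⊞_ : Seq → Seq → Seq
  (F ⊞ G) k = F k + G k

  infixr 8 _⊙_
  _⊙_ : Carrier → Seq → Seq
  (x ⊙ F) k = x * F k

  zeroSeq : Seq
  zeroSeq _ = 0#

  -- EGF of the constant 1.
  δ : Seq
  δ zero    = 1#
  δ (suc _) = 0#

  -- The EGF product, defined by the Leibniz rule.
  infixl 7 _⋆_
  _⋆_ : Seq → Seq → Seq
  (F ⋆ G) zero    = F 0 * G 0
  (F ⋆ G) (suc n) = (∂ F ⋆ G) n + (F ⋆ ∂ G) n

  ⋆-cong : ∀ {F F′ G G′} → F ≐ F′ → G ≐ G′ → F ⋆ G ≐ F′ ⋆ G′
  ⋆-cong F≐ G≐ zero    = *-cong (F≐ 0) (G≐ 0)
  ⋆-cong F≐ G≐ (suc n) = +-cong (⋆-cong (λ k → F≐ (suc k)) G≐ n) (⋆-cong F≐ (λ k → G≐ (suc k)) n)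

  ⋆-comm : ∀ F G → F ⋆ G ≐ G ⋆ F
  ⋆-comm F G zero    = *-comm _ _
  ⋆-comm F G (suc n) = trans (+-cong (⋆-comm (∂ F) G n) (⋆-comm F (∂ G) n)) (+-comm _ _)

  ⋆-distribʳ : ∀ F G H → (F ⊞ G) ⋆ H ≐ F ⋆ H ⊞ G ⋆ H
  ⋆-distribʳ F G H zero    = distribʳ _ _ _
  ⋆-distribʳ F G H (suc n) =
    trans (+-cong (⋆-distribʳ (∂ F) (∂ G) H n) (⋆-distribʳ F G (∂ H) n)) (+-interchange _ _ _ _)

  ⋆-distribˡ : ∀ F G H → F ⋆ (G ⊞ H) ≐ F ⋆ G ⊞ F ⋆ H
  ⋆-distribˡ F G H n = trans (⋆-comm F (G ⊞ H) n)
    (trans (⋆-distribʳ G H F n) (+-cong (⋆-comm G F n) (⋆-comm H F n)))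

  ⋆-scaleˡ : ∀ x F G → (x ⊙ F) ⋆ G ≐ x ⊙ (F ⋆ G)
  ⋆-scaleˡ x F G zero    = *-assoc _ _ _
  ⋆-scaleˡ x F G (suc n) =
    trans (+-cong (⋆-scaleˡ x (∂ F) G n) (⋆-scaleˡ x F (∂ G) n)) (sym (distribˡ _ _ _))

  ⋆-scaleʳ : ∀ x F G → F ⋆ (x ⊙ G) ≐ x ⊙ (F ⋆ G)
  ⋆-scaleʳ x F G n =
    trans (⋆-comm F (x ⊙ G) n) (trans (⋆-scaleˡ x G F n) (*-congˡ (⋆-comm G F n)))

  ⋆-zeroʳ : ∀ F → F ⋆ zeroSeq ≐ zeroSeq
  ⋆-zeroʳ F zero    = zeroʳ _
  ⋆-zeroʳ F (suc n) = trans (+-cong (⋆-zeroʳ (∂ F) n) (⋆-zeroʳ F n)) (+-identityˡ _)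

  ⋆-identityʳ : ∀ F → F ⋆ δ ≐ F
  ⋆-identityʳ F zero    = *-identityʳ _
  ⋆-identityʳ F (suc n) = trans (+-cong (⋆-identityʳ (∂ F) n) (⋆-zeroʳ F n)) (+-identityʳ _)

  ⋆-assoc : ∀ F G H → (F ⋆ G) ⋆ H ≐ F ⋆ (G ⋆ H)
  ⋆-assoc F G H zero    = *-assoc _ _ _
  ⋆-assoc F G H (suc n) = begin
    ((∂ F ⋆ G ⊞ F ⋆ ∂ G) ⋆ H) n + (F ⋆ G ⋆ ∂ H) n
      ≈⟨ +-congʳ (⋆-distribʳ (∂ F ⋆ G) (F ⋆ ∂ G) H n) ⟩
    ((∂ F ⋆ G ⋆ H) n + (F ⋆ ∂ G ⋆ H) n) + (F ⋆ G ⋆ ∂ H) n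
      ≈⟨ +-cong (+-cong (⋆-assoc (∂ F) G H n) (⋆-assoc F (∂ G) H n)) (⋆-assoc F G (∂ H) n) ⟩
    ((∂ F ⋆ (G ⋆ H)) n + (F ⋆ (∂ G ⋆ H)) n) + (F ⋆ (G ⋆ ∂ H)) n
      ≈⟨ +-assoc _ _ _ ⟩
    (∂ F ⋆ (G ⋆ H)) n + ((F ⋆ (∂ G ⋆ H)) n + (F ⋆ (G ⋆ ∂ H)) n)
      ≈⟨ +-congˡ (sym (⋆-distribˡ F (∂ G ⋆ H) (G ⋆ ∂ H) n)) ⟩
    (∂ F ⋆ (G ⋆ H)) n + (F ⋆ (∂ G ⋆ H ⊞ G ⋆ ∂ H)) n ∎

  -- Packaged as a commutative semigroup, to reuse the library's rearrangement laws.
  ⋆-commutativeSemigroup : CommutativeSemigroup c ℓ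
  ⋆-commutativeSemigroup = record
    { Carrier = Seq ; _≈_ = _≐_ ; _∙_ = _⋆_
    ; isCommutativeSemigroup = record
      { isSemigroup = record
        { isMagma = record
          { isEquivalence = record { refl = ≐-refl ; sym = ≐-sym ; trans = ≐-trans }
          ; ∙-cong = ⋆-cong }
        ; assoc = ⋆-assoc }
      ; comm = ⋆-comm } }

  open CommutativeSemigroupProperties ⋆-commutativeSemigroup
    using () renaming (interchange to ⋆-interchange; x∙yz≈y∙xz to ⋆-left-comm; x∙yz≈x∙zy to ⋆-right-swap)

  ⋆-pow : ∀ a b → pow a ⋆ pow b ≐ pow (a + b)
  ⋆-pow a b zero    = *-identityˡ _
  ⋆-pow a b (suc n) = begin
    (a ⊙ pow a ⋆ pow b) n + (pow a ⋆ b ⊙ pow b) n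
      ≈⟨ +-cong (⋆-scaleˡ a (pow a) (pow b) n) (⋆-scaleʳ b (pow a) (pow b) n) ⟩
    a * (pow a ⋆ pow b) n + b * (pow a ⋆ pow b) n  ≈⟨ sym (distribʳ _ _ _) ⟩
    (a + b) * (pow a ⋆ pow b) n                    ≈⟨ *-congˡ (⋆-pow a b n) ⟩
    (a + b) * pow (a + b) n                        ∎

  binomialSum : Seq → Seq → Seq
  binomialSum F G n = sumTo n (λ k → fromℕ (n C k) * (F k * G (n ∸ k)))

  binomialSum-leibniz : ∀ F G n →
    binomialSum F G (suc n) ≈ binomialSum (∂ F) G n + binomialSum F (∂ G) n
  binomialSum-leibniz F G n = begin
    binomialSum F G (suc n)
      ≈⟨ sumTo-shift n _ ⟩
    first + sumTo n (λ j → fromℕ (suc n C suc j) * X j)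
      ≈⟨ +-congˡ (sumTo-cong n pascal) ⟩
    first + sumTo n (λ j → fromℕ (n C j) * X j + fromℕ (n C suc j) * X j)
      ≈⟨ +-congˡ (sumTo-+ n _ _) ⟩
    first + (binomialSum (∂ F) G n + rest)
      ≈⟨ +-left-comm first _ rest ⟩
    binomialSum (∂ F) G n + (first + rest)
      ≈⟨ +-congˡ (sym (sumTo-shift n g)) ⟩
    binomialSum (∂ F) G n + (sumTo n g + g (suc n))
      ≈⟨ +-congˡ (+-congˡ (trans (*-congʳ (fromℕ-cong (k>n⇒nCk≡0 (ℕₚ.n<1+n n)))) (zeroˡ _))) ⟩
    binomialSum (∂ F) G n + (sumTo n g + 0#)
      ≈⟨ +-congˡ (trans (+-identityʳ _) (sumTo-cong≤ n realign)) ⟩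
    binomialSum (∂ F) G n + binomialSum F (∂ G) n ∎
    where
    X : ℕ → Carrier
    X j = F (suc j) * G (n ∸ j)
    first rest : Carrier
    first = fromℕ (suc n C 0) * (F 0 * G (suc n))
    rest  = sumTo n (λ j → fromℕ (n C suc j) * X j)
    g : ℕ → Carrier
    g k = fromℕ (n C k) * (F k * G (suc n ∸ k))
    pascal : ∀ j → fromℕ (suc n C suc j) * X j ≈ fromℕ (n C j) * X j + fromℕ (n C suc j) * X j
    pascal j = trans (*-congʳ (trans (fromℕ-cong (≡.sym (nCk+nC[k+1]≡[n+1]C[k+1] n j)))
                                     (fromℕ-+ (n C j) (n C suc j))))
                     (distribʳ _ _ _)
    realign : ∀ k → k ≤ n → g k ≈ fromℕ (n C k) * (F k * ∂ G (n ∸ k))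
    realign k k≤n = *-congˡ (*-congˡ (reflexive (≡.cong G (ℕₚ.+-∸-assoc 1 k≤n))))

  ⋆-binomial : ∀ F G → F ⋆ G ≐ binomialSum F G
  ⋆-binomial F G zero    = sym (fromℕ-1 _)
  ⋆-binomial F G (suc n) =
    trans (+-cong (⋆-binomial (∂ F) G n) (⋆-binomial F (∂ G) n)) (sym (binomialSum-leibniz F G n))

  -- (F ⋆ U) n = lower F U n + F n · U 0, where the lower part only involves
  -- the coefficients F k with k < n.
  lower : Seq → Seq → Seq
  lower F U zero    = 0#
  lower F U (suc n) = lower (∂ F) U n + (F ⋆ ∂ U) n

  ⋆-top : ∀ F U n → (F ⋆ U) n ≈ lower F U n + F n * U 0
  ⋆-top F U zero    = sym (+-identityˡ _)
  ⋆-top F U (suc n) = trans (+-congʳ (⋆-top (∂ F) U n)) (+-right-comm _ _ _)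

  ⋆-congˡ-upTo : ∀ n {F G} U → (∀ k → k ≤ n → F k ≈ G k) → (F ⋆ U) n ≈ (G ⋆ U) n
  ⋆-congˡ-upTo zero    U F≈G = *-congʳ (F≈G 0 z≤n)
  ⋆-congˡ-upTo (suc n) U F≈G =
    +-cong (⋆-congˡ-upTo n U (λ k k≤n → F≈G (suc k) (s≤s k≤n)))
           (⋆-congˡ-upTo n (∂ U) (λ k k≤n → F≈G k (ℕₚ.m≤n⇒m≤1+n k≤n)))

  lower-congˡ : ∀ n {F G} U → (∀ k → k < n → F k ≈ G k) → lower F U n ≈ lower G U n
  lower-congˡ zero    U F≈G = refl
  lower-congˡ (suc n) U F≈G =
    +-cong (lower-congˡ n U (λ k k<n → F≈G (suc k) (s≤s k<n)))
           (⋆-congˡ-upTo n (∂ U) (λ k k≤n → F≈G k (s≤s k≤n)))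

  ⋆-cancelʳ : ∀ {U v} → v * U 0 ≈ 1# → ∀ {F G} → F ⋆ U ≐ G ⋆ U → F ≐ G
  ⋆-cancelʳ {U} {v} inv {F} {G} eq n = top n (agree n)
    where
    unscale : ∀ x → (x * U 0) * v ≈ x
    unscale x = trans (*-assoc x (U 0) v) (trans (*-congˡ (trans (*-comm (U 0) v) inv)) (*-identityʳ x))
    top : ∀ n → (∀ k → k < n → F k ≈ G k) → F n ≈ G n
    top n below = begin
      F n              ≈⟨ sym (unscale (F n)) ⟩
      (F n * U 0) * v  ≈⟨ *-congʳ (∙-cancelˡ (lower F U n) _ _ tops) ⟩
      (G n * U 0) * v  ≈⟨ unscale (G n) ⟩
      G n              ∎
      where
      tops : lower F U n + F n * U 0 ≈ lower F U n + G n * U 0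
      tops = trans (sym (⋆-top F U n)) (trans (eq n)
               (trans (⋆-top G U n) (+-congʳ (sym (lower-congˡ n U below)))))
    agree : ∀ n k → k < n → F k ≈ G k
    agree (suc n) k k<1+n with ℕₚ.m<1+n⇒m<n∨m≡n k<1+n
    ... | inj₁ k<n    = agree n k k<n
    ... | inj₂ ≡.refl = top n (agree n)

  -- EGF of e^{st} + 1; its constant term is 2.
  den : Carrier → Seq
  den s = pow s ⊞ δ

  den-cong : ∀ {s t} → s ≈ t → den s ≐ den t
  den-cong s≈t n = +-congʳ (pow-cong n s≈t)

  ⋆-pow-triple : ∀ α β γ → (two ⊙ pow α) ⋆ ((two ⊙ pow β) ⋆ (two ⊙ pow γ))
                           ≐ two ⊙ (two ⊙ (two ⊙ pow (α + (β + γ))))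
  ⋆-pow-triple α β γ n = begin
    ((two ⊙ pow α) ⋆ W) n                   ≈⟨ ⋆-scaleˡ two (pow α) W n ⟩
    two * (pow α ⋆ W) n                     ≈⟨ *-congˡ (⋆-cong ≐-refl inner n) ⟩
    two * (pow α ⋆ two ⊙ (two ⊙ pow (β + γ))) n
      ≈⟨ *-congˡ (trans (⋆-scaleʳ two _ _ n) (*-congˡ (⋆-scaleʳ two _ _ n))) ⟩
    two * (two * (two * (pow α ⋆ pow (β + γ)) n))
      ≈⟨ *-congˡ (*-congˡ (*-congˡ (⋆-pow α (β + γ) n))) ⟩
    two * (two * (two * pow (α + (β + γ)) n)) ∎
    where
    W : Seq
    W = (two ⊙ pow β) ⋆ (two ⊙ pow γ)
    inner : W ≐ two ⊙ (two ⊙ pow (β + γ))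
    inner m = trans (⋆-scaleˡ two (pow β) (two ⊙ pow γ) m)
      (*-congˡ (trans (⋆-scaleʳ two (pow β) (pow γ) m) (*-congˡ (⋆-pow β γ m))))

  module Euler (h : Carrier) (h*2≈1 : h * two ≈ 1#) where

    binSum≈sumTo : ∀ N m x → binSum h N m x ≈ sumTo m (λ k → fromℕ (N C k) * E h k x)
    binSum≈sumTo N zero    x = refl
    binSum≈sumTo N (suc m) x = +-congʳ (binSum≈sumTo N m x)

    halving : ∀ B X → (B + (X - h * B)) + (X - h * B) ≈ two * X
    halving B X = begin
      (B + (X - hB)) + (X - hB)          ≈⟨ +-assoc B _ _ ⟩
      B + ((X - hB) + (X - hB))          ≈⟨ +-congˡ (+-interchange X (- hB) X (- hB)) ⟩
      B + ((X + X) + (- hB + - hB))      ≈⟨ +-congˡ (+-congˡ (trans (⁻¹-∙-comm hB hB) (-‿cong hB+hB≈B))) ⟩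
      B + ((X + X) - B)                  ≈⟨ +-left-comm B (X + X) (- B) ⟩
      (X + X) + (B - B)                  ≈⟨ +-congˡ (-‿inverseʳ B) ⟩
      (X + X) + 0#                       ≈⟨ +-identityʳ _ ⟩
      X + X                              ≈⟨ sym (two*-double X) ⟩
      two * X                            ∎
      where
      hB : Carrier
      hB = h * B
      hB+hB≈B : hB + hB ≈ B
      hB+hB≈B = trans (sym (two*-double hB)) (trans (sym (*-assoc two h B))
                  (trans (*-congʳ (trans (*-comm two h) h*2≈1)) (*-identityˡ B)))

    E-recurrence : ∀ n x → sumTo n (λ k → fromℕ (n C k) * E h k x) + E h n x ≈ two * pow x n
    E-recurrence zero    x = trans (+-congʳ (fromℕ-1 1#)) (sym (*-identityʳ two))
    E-recurrence (suc n) x = begin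
      (sumTo n (λ k → fromℕ (suc n C k) * E h k x) + fromℕ (suc n C suc n) * Eₙ₊₁) + Eₙ₊₁
        ≈⟨ +-congʳ (+-cong (sym (binSum≈sumTo (suc n) n x))
             (trans (*-congʳ (fromℕ-cong (nCn≡1 (suc n)))) (fromℕ-1 Eₙ₊₁))) ⟩
      (binSum h (suc n) n x + Eₙ₊₁) + Eₙ₊₁
        ≈⟨ halving (binSum h (suc n) n x) (pow x (suc n)) ⟩
      two * pow x (suc n) ∎
      where
      Eₙ₊₁ : Carrier
      Eₙ₊₁ = E h (suc n) x

    -- Ê(x,s) = (E_k(x) sᵏ)_k, the EGF of 2e^{xst}/(e^{st}+1).
    Ê : Carrier → Carrier → Seq
    Ê x s k = E h k x * pow s k

    Ê-generating : ∀ x s → Ê x s ⋆ den s ≐ two ⊙ pow (x * s)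
    Ê-generating x s n = begin
      (Ê x s ⋆ den s) n
        ≈⟨ trans (⋆-distribˡ (Ê x s) (pow s) δ n) (+-cong (⋆-binomial (Ê x s) (pow s) n) (⋆-identityʳ (Ê x s) n)) ⟩
      binomialSum (Ê x s) (pow s) n + Ê x s n
        ≈⟨ +-cong (sumTo-cong≤ n collect) (*-comm _ _) ⟩
      sumTo n (λ k → pow s n * (fromℕ (n C k) * E h k x)) + pow s n * E h n x
        ≈⟨ +-congʳ (sym (sumTo-*ˡ n (pow s n) _)) ⟩
      pow s n * sumTo n (λ k → fromℕ (n C k) * E h k x) + pow s n * E h n x
        ≈⟨ sym (distribˡ _ _ _) ⟩
      pow s n * (sumTo n (λ k → fromℕ (n C k) * E h k x) + E h n x)
        ≈⟨ *-congˡ (E-recurrence n x) ⟩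
      pow s n * (two * pow x n)
        ≈⟨ trans (*-left-comm (pow s n) two (pow x n)) (*-congˡ (*-comm (pow s n) (pow x n))) ⟩
      two * (pow x n * pow s n)
        ≈⟨ *-congˡ (sym (pow-* x s n)) ⟩
      two * pow (x * s) n ∎
      where
      collect : ∀ k → k ≤ n → fromℕ (n C k) * (Ê x s k * pow s (n ∸ k))
                              ≈ pow s n * (fromℕ (n C k) * E h k x)
      collect k k≤n = begin
        fromℕ (n C k) * ((E h k x * pow s k) * pow s (n ∸ k))
          ≈⟨ *-congˡ (*-assoc _ _ _) ⟩
        fromℕ (n C k) * (E h k x * (pow s k * pow s (n ∸ k)))
          ≈⟨ *-congˡ (*-congˡ (trans (sym (pow-+ s k (n ∸ k))) (reflexive (≡.cong (pow s) (ℕₚ.m+[n∸m]≡n k≤n))))) ⟩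
        fromℕ (n C k) * (E h k x * pow s n)
          ≈⟨ trans (sym (*-assoc _ _ _)) (*-comm _ _) ⟩
        pow s n * (fromℕ (n C k) * E h k x) ∎

    module Symmetry (y₁ y₂ y₃ : Carrier) where

      T : Carrier → Carrier → Carrier → Seq
      T a b c′ = Ê (a * y₁) (b * c′) ⋆ (Ê (b * y₂) (a * c′) ⋆ Ê (c′ * y₃) (a * b))

      Q : Carrier → Carrier → Carrier → Seq
      Q a b c′ = den (b * c′) ⋆ (den (a * c′) ⋆ den (a * b))

      -- Each exponent x·s equals abc·yᵢ, so the total exponent is abc(y₁+y₂+y₃).
      exponent : ∀ a b c′ → (a * y₁) * (b * c′) + ((b * y₂) * (a * c′) + (c′ * y₃) * (a * b))
                            ≈ (a * (b * c′)) * (y₁ + (y₂ + y₃))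
      exponent a b c′ = begin
        (a * y₁) * (b * c′) + ((b * y₂) * (a * c′) + (c′ * y₃) * (a * b))
          ≈⟨ +-cong (*-Solver.solve 4 (λ a b c y → (a ⊕ y) ⊕ (b ⊕ c) ⊜ (a ⊕ (b ⊕ c)) ⊕ y) refl a b c′ y₁)
             (+-cong (*-Solver.solve 4 (λ a b c y → (b ⊕ y) ⊕ (a ⊕ c) ⊜ (a ⊕ (b ⊕ c)) ⊕ y) refl a b c′ y₂)
                     (*-Solver.solve 4 (λ a b c y → (c ⊕ y) ⊕ (a ⊕ b) ⊜ (a ⊕ (b ⊕ c)) ⊕ y) refl a b c′ y₃)) ⟩
        p * y₁ + (p * y₂ + p * y₃)
          ≈⟨ trans (+-congˡ (sym (distribˡ p y₂ y₃))) (sym (distribˡ p y₁ (y₂ + y₃))) ⟩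
        p * (y₁ + (y₂ + y₃)) ∎
        where
        open *-Solver using (_⊕_; _⊜_)
        p : Carrier
        p = a * (b * c′)

      T⋆Q : ∀ a b c′ → T a b c′ ⋆ Q a b c′ ≐ two ⊙ (two ⊙ (two ⊙ pow ((a * (b * c′)) * (y₁ + (y₂ + y₃)))))
      T⋆Q a b c′ = ≐-trans regroup (≐-trans (⋆-cong (Ê-generating _ _) (⋆-cong (Ê-generating _ _) (Ê-generating _ _)))
                     (≐-trans (⋆-pow-triple _ _ _) (λ n → *-congˡ (*-congˡ (*-congˡ (pow-cong n (exponent a b c′)))))))
        where
        regroup : T a b c′ ⋆ Q a b c′
                  ≐ (Ê (a * y₁) (b * c′) ⋆ den (b * c′))
                    ⋆ ((Ê (b * y₂) (a * c′) ⋆ den (a * c′)) ⋆ (Ê (c′ * y₃) (a * b) ⋆ den (a * b)))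
        regroup = ≐-trans (⋆-interchange _ _ _ _) (⋆-cong ≐-refl (⋆-interchange _ _ _ _))

      Q-invertible : ∀ a b c′ → (h * (h * h)) * Q a b c′ 0 ≈ 1#
      Q-invertible a b c′ = inverse-* h*2≈1 (inverse-* h*2≈1 h*2≈1)

      -- T only depends on abc and on Q, hence on the multiset {a,b,c}.
      T-invariant : ∀ {a b c′ a′ b′ c″} → a′ * (b′ * c″) ≈ a * (b * c′) → Q a′ b′ c″ ≐ Q a b c′ →
                    T a′ b′ c″ ≐ T a b c′
      T-invariant {a} {b} {c′} {a′} {b′} {c″} p′≈p Q′≐Q = ⋆-cancelʳ (Q-invertible a b c′) (λ n → begin
        (T a′ b′ c″ ⋆ Q a b c′) n   ≈⟨ ⋆-cong ≐-refl (≐-sym Q′≐Q) n ⟩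
        (T a′ b′ c″ ⋆ Q a′ b′ c″) n ≈⟨ T⋆Q a′ b′ c″ n ⟩
        two * (two * (two * pow ((a′ * (b′ * c″)) * Y) n))
          ≈⟨ *-congˡ (*-congˡ (*-congˡ (pow-cong n (*-congʳ p′≈p)))) ⟩
        two * (two * (two * pow ((a * (b * c′)) * Y) n)) ≈⟨ T⋆Q a b c′ n ⟨
        (T a b c′ ⋆ Q a b c′) n     ∎)
        where
        Y : Carrier
        Y = y₁ + (y₂ + y₃)

      -- The two transpositions generating all permutations of (a,b,c).
      T-swap₁₂ : ∀ a b c′ → T b a c′ ≐ T a b c′
      T-swap₁₂ a b c′ = T-invariant (*-left-comm b a c′)
        (≐-trans (⋆-cong ≐-refl (⋆-cong ≐-refl (den-cong (*-comm b a)))) (⋆-left-comm _ _ _))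

      T-swap₂₃ : ∀ a b c′ → T a c′ b ≐ T a b c′
      T-swap₂₃ a b c′ = T-invariant (*-congˡ (*-comm c′ b))
        (≐-trans (⋆-cong (den-cong (*-comm c′ b)) ≐-refl) (⋆-right-swap _ _ _))

      summand : ∀ n a b c′ k l m (C₁ C₂ : ℕ) → multinomial n k l m ≡ C₁ ℕ.* C₂ →
        fromℕ C₁ * (Ê (a * y₁) (b * c′) k * (fromℕ C₂ * (Ê (b * y₂) (a * c′) l * Ê (c′ * y₃) (a * b) m)))
        ≈ fromℕ (multinomial n k l m)
            * E h k (a * y₁) * E h l (b * y₂) * E h m (c′ * y₃)
            * pow a (l ℕ.+ m) * pow b (k ℕ.+ m) * pow c′ (k ℕ.+ l)
      summand n a b c′ k l m C₁ C₂ split = begin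
        fromℕ C₁ * ((Eₖ * pow (b * c′) k) * (fromℕ C₂ * ((Eₗ * pow (a * c′) l) * (Eₘ * pow (a * b) m))))
          ≈⟨ *-congˡ (*-cong (*-congˡ (pow-* b c′ k))
               (*-congˡ (*-cong (*-congˡ (pow-* a c′ l)) (*-congˡ (pow-* a b m))))) ⟩
        fromℕ C₁ * ((Eₖ * (pow b k * pow c′ k))
          * (fromℕ C₂ * ((Eₗ * (pow a l * pow c′ l)) * (Eₘ * (pow a m * pow b m)))))
          ≈⟨ *-Solver.solve 11 (λ c1 c2 ek el em al am bk bm ck cl →
               c1 ⊕ ((ek ⊕ (bk ⊕ ck)) ⊕ (c2 ⊕ ((el ⊕ (al ⊕ cl)) ⊕ (em ⊕ (am ⊕ bm)))))
               ⊜ ((((((c1 ⊕ c2) ⊕ ek) ⊕ el) ⊕ em) ⊕ (al ⊕ am)) ⊕ (bk ⊕ bm)) ⊕ (ck ⊕ cl))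
               refl (fromℕ C₁) (fromℕ C₂) Eₖ Eₗ Eₘ (pow a l) (pow a m) (pow b k) (pow b m) (pow c′ k) (pow c′ l) ⟩
        (fromℕ C₁ * fromℕ C₂) * Eₖ * Eₗ * Eₘ * (pow a l * pow a m) * (pow b k * pow b m) * (pow c′ k * pow c′ l)
          ≈⟨ *-cong (*-cong (*-cong (*-congʳ (*-congʳ (*-congʳ coefficient)))
               (sym (pow-+ a l m))) (sym (pow-+ b k m))) (sym (pow-+ c′ k l)) ⟩
        fromℕ (multinomial n k l m) * Eₖ * Eₗ * Eₘ * pow a (l ℕ.+ m) * pow b (k ℕ.+ m) * pow c′ (k ℕ.+ l) ∎
        where
        open *-Solver using (_⊕_; _⊜_)
        Eₖ Eₗ Eₘ : Carrier
        Eₖ = E h k (a * y₁)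
        Eₗ = E h l (b * y₂)
        Eₘ = E h m (c′ * y₃)
        coefficient : fromℕ C₁ * fromℕ C₂ ≈ fromℕ (multinomial n k l m)
        coefficient = trans (sym (fromℕ-* C₁ C₂)) (fromℕ-cong (≡.sym split))

      S≈T : ∀ a b c′ n → S h n a b c′ y₁ y₂ y₃ ≈ T a b c′ n
      S≈T a b c′ n = sym (begin
        (F₁ ⋆ (F₂ ⋆ F₃)) n
          ≈⟨ ⋆-binomial F₁ (F₂ ⋆ F₃) n ⟩
        binomialSum F₁ (F₂ ⋆ F₃) n
          ≈⟨ sumTo-cong n (λ k → *-congˡ (*-congˡ (⋆-binomial F₂ F₃ (n ∸ k)))) ⟩
        sumTo n (λ k → fromℕ (n C k) * (F₁ k * binomialSum F₂ F₃ (n ∸ k)))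
          ≈⟨ sumTo-cong n (λ k → trans (*-congˡ (sumTo-*ˡ (n ∸ k) (F₁ k) _)) (sumTo-*ˡ (n ∸ k) (fromℕ (n C k)) _)) ⟩
        sumTo n (λ k → sumTo (n ∸ k) (λ l →
          fromℕ (n C k) * (F₁ k * (fromℕ ((n ∸ k) C l) * (F₂ l * F₃ (n ∸ k ∸ l))))))
          ≈⟨ sumTo-cong≤ n (λ k k≤n → sumTo-cong≤ (n ∸ k) (λ l l≤n-k →
               summand n a b c′ k l (n ∸ k ∸ l) (n C k) ((n ∸ k) C l) (multinomial-split k≤n l≤n-k))) ⟩
        S h n a b c′ y₁ y₂ y₃ ∎)
        where
        F₁ F₂ F₃ : Seq
        F₁ = Ê (a * y₁) (b * c′)
        F₂ = Ê (b * y₂) (a * c′)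
        F₃ = Ê (c′ * y₃) (a * b)

      S-from-T : ∀ a b c′ a′ b′ c″ n → T a b c′ ≐ T a′ b′ c″ →
                 S h n a b c′ y₁ y₂ y₃ ≈ S h n a′ b′ c″ y₁ y₂ y₃
      S-from-T a b c′ a′ b′ c″ n T≐T′ = trans (S≈T a b c′ n) (trans (T≐T′ n) (sym (S≈T a′ b′ c″ n)))

theorem1 : {c ℓ : Level} (R : CommutativeRing c ℓ) →
    let open CommutativeRing R
        open Ring R
    in (h : Carrier) → h * (1# + 1#) ≈ 1# →
       (w₁ w₂ w₃ : ℕ) → NonZero w₁ → NonZero w₂ → NonZero w₃ →
       (n : ℕ) → (y₁ y₂ y₃ : Carrier) →
       let a₁ = fromℕ w₁
           a₂ = fromℕ w₂
           a₃ = fromℕ w₃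
       in (S h n a₁ a₂ a₃ y₁ y₂ y₃ ≈ S h n a₁ a₃ a₂ y₁ y₂ y₃)
          × (S h n a₁ a₃ a₂ y₁ y₂ y₃ ≈ S h n a₂ a₁ a₃ y₁ y₂ y₃)
          × (S h n a₂ a₁ a₃ y₁ y₂ y₃ ≈ S h n a₂ a₃ a₁ y₁ y₂ y₃)
          × (S h n a₂ a₃ a₁ y₁ y₂ y₃ ≈ S h n a₃ a₁ a₂ y₁ y₂ y₃)
          × (S h n a₃ a₁ a₂ y₁ y₂ y₃ ≈ S h n a₃ a₂ a₁ y₁ y₂ y₃)
theorem1 R h h*2≈1 w₁ w₂ w₃ _ _ _ n y₁ y₂ y₃ =
    S-from-T a₁ a₂ a₃ a₁ a₃ a₂ n (≐-sym (T-swap₂₃ a₁ a₂ a₃))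
  , S-from-T a₁ a₃ a₂ a₂ a₁ a₃ n (≐-trans (T-swap₂₃ a₁ a₂ a₃) (≐-sym (T-swap₁₂ a₁ a₂ a₃)))
  , S-from-T a₂ a₁ a₃ a₂ a₃ a₁ n (≐-sym (T-swap₂₃ a₂ a₁ a₃))
  , S-from-T a₂ a₃ a₁ a₃ a₁ a₂ n (≐-trans (T-swap₁₂ a₃ a₂ a₁) (T-swap₂₃ a₃ a₁ a₂))
  , S-from-T a₃ a₁ a₂ a₃ a₂ a₁ n (≐-sym (T-swap₂₃ a₃ a₁ a₂))
  where
  open Ring R using (fromℕ)
  open Series R
  open Euler h h*2≈1
  open Symmetry y₁ y₂ y₃
  a₁ a₂ a₃ : CommutativeRing.Carrier R
  a₁ = fromℕ w₁
  a₂ = fromℕ w₂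
  a₃ = fromℕ w₃
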